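{- Let $f:\mathbb{F}_2^n\to\mathbb{F}_2^n$ be a conjunctive Boolean network such that every strongly connected component of its dependency graph $\mathfrak{D}(f)$ contains at least one edge. Form a graph $\mathfrak{D}'$ from $\mathfrak{D}(f)$ as follows: for every ordered pair of distinct strongly connected components $G_i,G_j$ such that there is at least one edge from a vertex of $G_i$ to a vertex of $G_j$, delete all but one of these edges. Let $g$ be the conjunctive Boolean network with $\mathfrak{D}(g)=\mathfrak{D}'$. Then every limit cycle in the phase space of $f$ is a limit cycle in the phase space of $g$; in particular $\mathcal{C}(f)\le\mathcal{C}(g)$ coefficientwise.
   Context: $\mathbb{F}_2=\{0,1\}$. A conjunctive Boolean network is a map $f=(f_1,\dots,f_n):\mathbb{F}_2^n\to\mathbb{F}_2^n$ where each $f_i$ is a product (AND) of a nonempty set of variables. Its dependency graph $\mathfrak{D}(f)$ has vertices $1,\dots,n$ and an edge $i\to j$ iff $x_i$ appears in $f_j$; each directed graph in which every vertex has positive in-degree is the dependency graph of a unique conjunctive network. Strongly connected components are the subgraphs induced on the classes of mutual reachability. A limit cycle of length $t$ is a set $\{\mathbf{u},\dots,f^{t-1}(\mathbf{u})\}$ with $f^t(\mathbf{u})=\mathbf{u}$, $t$ minimal. The cycle structure is the formal sum $\mathcal{C}(f)=\sum_i C(f)_i\mathcal{C}_i$, $C(f)_i$ the number of limit cycles of length $i$. -}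

module Defs where

open import Data.Bool using (Bool; true; false; _∧_; _∨_; not; T)
open import Data.Bool.Properties using () renaming (_≟_ to _≟B_)
open import Data.Nat using (ℕ; zero; suc; _<_; _≤_; _/_)
open import Data.Nat.Properties using (_≟_)
open import Data.Fin using (Fin; toℕ)
open import Data.Fin.Properties using (all?)
open import Data.Vec using (Vec; []; _∷_; lookup; tabulate)
open import Data.Vec.Properties using (≡-dec)
open import Data.List using (List; []; _∷_; map; _++_; allFin; filter; length)
open import Data.Bool.ListAction using (and)
open import Data.Product using (Σ; ∃; _×_; _,_)
open import Relation.Binary.PropositionalEquality using (_≡_; _≢_)
open import Relation.Binary.Construct.Closure.ReflexiveTransitive using (Star)
open import Relation.Nullary using (Dec; yes; no; ¬_)
open import Relation.Nullary.Decidable using (_×-dec_; ¬?)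
open import Data.Nat.Properties using (_<?_)

-- A directed graph on vertices Fin n, given by its (decidable) adjacency:
-- there is an edge i → j iff  E i j ≡ true.
Graph : ℕ → Set
Graph n = Fin n → Fin n → Bool

Edge : ∀ {n} → Graph n → Fin n → Fin n → Set
Edge E i j = T (E i j)

PositiveInDegree : ∀ {n} → Graph n → Set
PositiveInDegree {n} E = ∀ (j : Fin n) → ∃ λ (i : Fin n) → Edge E i j

State : ℕ → Set
State n = Vec Bool n

-- The conjunctive Boolean network with dependency graph E:
-- f_j(x) = AND of x_i over all i with an edge i → j.
conj : ∀ {n} → Graph n → State n → State n
conj {n} E x = tabulate λ j → and (map (λ i → not (E i j) ∨ lookup x i) (allFin n))

iter : ∀ {A : Set} → (A → A) → ℕ → A → A
iter f zero    x = x
iter f (suc k) x = f (iter f k x)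

Reach : ∀ {n} → Graph n → Fin n → Fin n → Set
Reach E = Star (Edge E)

SameSCC : ∀ {n} → Graph n → Fin n → Fin n → Set
SameSCC E i j = Reach E i j × Reach E j i

EverySCCHasEdge : ∀ {n} → Graph n → Set
EverySCCHasEdge {n} E = ∀ (i : Fin n) →
  ∃ λ (u : Fin n) → ∃ λ (v : Fin n) → SameSCC E i u × SameSCC E i v × Edge E u v

IsReduction : ∀ {n} → Graph n → Graph n → Set
IsReduction {n} D D' =
    (∀ (i j : Fin n) → Edge D' i j → Edge D i j)
  × (∀ (i j : Fin n) → SameSCC D i j → Edge D i j → Edge D' i j)
  × (∀ (u v : Fin n) → ¬ SameSCC D u v → Edge D u v →
       (∃ λ (a : Fin n) → ∃ λ (b : Fin n) →
          SameSCC D u a × SameSCC D v b × Edge D' a b)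
     × (∀ (a b a' b' : Fin n) →
          SameSCC D u a → SameSCC D v b → Edge D' a b →
          SameSCC D u a' → SameSCC D v b' → Edge D' a' b' →
          (a ≡ a') × (b ≡ b')))

MinPeriod : ∀ {A : Set} → (A → A) → A → ℕ → Set
MinPeriod f u t =
  (0 < t) × (iter f t u ≡ u) × (∀ (s : Fin t) → toℕ s ≢ 0 → iter f (toℕ s) u ≢ u)

InOrbit : ∀ {A : Set} → (A → A) → A → ℕ → A → Set
InOrbit f u t x = ∃ λ (k : ℕ) → (k < t) × (x ≡ iter f k u)

IsLimitCycle : ∀ {A : Set} → (A → A) → (A → Set) → ℕ → Set
IsLimitCycle {A} f S t = ∃ λ (u : A) → MinPeriod f u t × (∀ x → S x → InOrbit f u t x) × (∀ x → InOrbit f u t x → S x)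

allStates : ∀ n → List (State n)
allStates zero    = [] ∷ []
allStates (suc n) = map (false ∷_) (allStates n) ++ map (true ∷_) (allStates n)

minPeriod? : ∀ {n} (f : State n → State n) (u : State n) (t : ℕ) → Dec (MinPeriod f u t)
minPeriod? f u t =
  (0 <? t) ×-dec (≡-dec _≟B_ (iter f t u) u)
    ×-dec all? (λ s → ¬? (toℕ s ≟ 0) →-dec ¬? (≡-dec _≟B_ (iter f (toℕ s) u) u))
  where
  _→-dec_ : ∀ {P Q : Set} → Dec P → Dec Q → Dec (P → Q)
  _        →-dec yes q = yes (λ _ → q)
  yes p    →-dec no ¬q = no (λ h → ¬q (h p))
  no ¬p    →-dec no _  = yes (λ p → Data.Empty.⊥-elim (¬p p))
    where import Data.Empty

-- C(f)_{k+1}: number of limit cycles of length k+1, i.e. the number of states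
-- of minimal period k+1 divided by k+1 (each such cycle has exactly k+1 states).
cycleCount : ∀ {n} → (State n → State n) → ℕ → ℕ
cycleCount {n} f k = length (filter (λ u → minPeriod? f u (suc k)) (allStates n)) / suc k

-- A conjunctive network propagates 0s forward along edges.  On a periodic
-- state y of f, a 0 entering a strongly connected component would travel
-- around a closed walk inside it forever, and periodicity then forces the 0
-- to have been present already; hence (f y)_j = 1 as soon as the predecessor
-- of j inside its component is 1.  Since g keeps every edge inside a
-- component and only drops edges, f and g agree on the periodic states of f,
-- so every limit cycle of f is traced out verbatim by g.
module Submission where

open import Defs
open import Data.Bool using (true; false; _∨_; not; T)
open import Data.Bool.Properties using (T?)
open import Data.Empty using (⊥-elim)
open import Data.Fin using (toℕ)
open import Data.List using (allFin)
open import Data.List.Relation.Binary.Sublist.Propositional using (⊆-refl)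
open import Data.List.Relation.Binary.Sublist.Propositional.Properties
  using (filter⁺; length-mono-≤)
open import Data.List.Relation.Unary.All.Properties using (all⁺; all⁻; tabulate⁺; tabulate⁻)
open import Data.Nat using (ℕ; zero; suc; _+_; _*_; _≤_)
open import Data.Nat.DivMod using (/-monoˡ-≤)
open import Data.Nat.Properties using (+-comm; *-comm)
open import Data.Product using (_×_; _,_; ∃)
open import Data.Vec using (Vec; lookup)
open import Data.Vec.Properties using (lookup∘tabulate; tabulate∘lookup; tabulate-cong)
open import Relation.Binary.Construct.Closure.ReflexiveTransitive using (ε; _◅_; _◅◅_)
open import Relation.Binary.PropositionalEquality
open import Relation.Nullary using (¬_)
open import Relation.Nullary.Decidable using (decidable-stable)

module _ {A : Set} (f : A → A) where

  iter-+ : ∀ m k x → iter f (m + k) x ≡ iter f m (iter f k x)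
  iter-+ zero    k x = refl
  iter-+ (suc m) k x = cong f (iter-+ m k x)

  iter-comm : ∀ m k x → iter f m (iter f k x) ≡ iter f k (iter f m x)
  iter-comm m k x = begin
    iter f m (iter f k x) ≡⟨ sym (iter-+ m k x) ⟩
    iter f (m + k) x      ≡⟨ cong (λ s → iter f s x) (+-comm m k) ⟩
    iter f (k + m) x      ≡⟨ iter-+ k m x ⟩
    iter f k (iter f m x) ∎
    where open ≡-Reasoning

  iter-suc : ∀ k x → iter f (suc k) x ≡ iter f k (f x)
  iter-suc k = iter-comm 1 k

  iter-*-fixed : ∀ t {y} → iter f t y ≡ y → ∀ m → iter f (m * t) y ≡ y
  iter-*-fixed t p zero    = refl
  iter-*-fixed t p (suc m) =
    trans (iter-+ t (m * t) _) (trans (cong (iter f t) (iter-*-fixed t p m)) p)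

  Periodic : A → Set
  Periodic y = ∃ λ k → iter f (suc k) y ≡ y

  periodic-iter : ∀ {y} → Periodic y → ∀ m → Periodic (iter f m y)
  periodic-iter (k , p) m = k , trans (iter-comm (suc k) m _) (cong (iter f m) p)

module _ {A : Set} (f g : A → A) (agree : ∀ y → Periodic f y → f y ≡ g y) where

  iter-agree : ∀ {u} → Periodic f u → ∀ m → iter g m u ≡ iter f m u
  iter-agree per zero    = refl
  iter-agree per (suc m) =
    trans (cong g (iter-agree per m)) (sym (agree _ (periodic-iter f per m)))

  minPeriod-transfer : ∀ {u t} → MinPeriod f u t → MinPeriod g u t
  minPeriod-transfer {t = suc k} (pos , p , minimal) =
    pos , trans (same (suc k)) p , λ s s≢0 q → minimal s s≢0 (trans (sym (same (toℕ s))) q)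
    where same = iter-agree (k , p)

  limitCycle-transfer : ∀ {S t} → IsLimitCycle f S t → IsLimitCycle g S t
  limitCycle-transfer {t = suc k} (u , mp@(_ , p , _) , S⊆orbit , orbit⊆S) =
    u , minPeriod-transfer mp ,
    (λ x Sx → let i , i<t , x≡ = S⊆orbit x Sx in i , i<t , trans x≡ (sym (same i))) ,
    (λ x (i , i<t , x≡) → orbit⊆S x (i , i<t , trans x≡ (same i)))
    where same = iter-agree (k , p)

cycleCount-mono : ∀ {n} (f g : State n → State n) k →
  (∀ u → MinPeriod f u (suc k) → MinPeriod g u (suc k)) → cycleCount f k ≤ cycleCount g k
cycleCount-mono f g k f⇒g = /-monoˡ-≤ (suc k) (length-mono-≤
  (filter⁺ (λ u → minPeriod? f u (suc k)) (λ u → minPeriod? g u (suc k))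
           (λ { refl → f⇒g _ }) (⊆-refl {x = allStates _})))

T-injective : ∀ {x y} → (T x → T y) → (T y → T x) → x ≡ y
T-injective {false} {false} _   _   = refl
T-injective {false} {true}  _   y⇒x = ⊥-elim (y⇒x _)
T-injective {true}  {false} x⇒y _   = ⊥-elim (x⇒y _)
T-injective {true}  {true}  _   _   = refl

lookup-extensionality : ∀ {A : Set} {n} {xs ys : Vec A n} →
  (∀ i → lookup xs i ≡ lookup ys i) → xs ≡ ys
lookup-extensionality {xs = xs} {ys} eq =
  trans (sym (tabulate∘lookup xs)) (trans (tabulate-cong eq) (tabulate∘lookup ys))

walkLength : ∀ {n} {E : Graph n} {i j} → Reach E i j → ℕ
walkLength ε       = zero
walkLength (_ ◅ p) = suc (walkLength p)

module _ {n} (E : Graph n) where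

  private
    F : State n → State n
    F = conj E

  -- The clause of i in the j-th conjunction is  E i j ⇒ x_i.
  conj-true⇒ : ∀ x j → T (lookup (F x) j) → ∀ i → Edge E i j → T (lookup x i)
  conj-true⇒ x j Fxj i e = implies (E i j) e (tabulate⁻ (all⁺ _ (allFin n) Fxj') i)
    where
    Fxj' = subst T (lookup∘tabulate _ j) Fxj
    implies : ∀ b {c} → T b → T (not b ∨ c) → T c
    implies true _ c = c

  conj-true⇐ : ∀ x j → (∀ i → Edge E i j → T (lookup x i)) → T (lookup (F x) j)
  conj-true⇐ x j ins =
    subst T (sym (lookup∘tabulate _ j)) (all⁻ _ (tabulate⁺ λ i → implied (E i j) (ins i)))
    where
    implied : ∀ b {c} → (T b → T c) → T (not b ∨ c)
    implied true  c = c _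
    implied false _ = _

  zero-propagates : ∀ {i j} (p : Reach E i j) {x} →
    ¬ T (lookup x i) → ¬ T (lookup (iter F (walkLength p) x) j)
  zero-propagates ε                    x≢1 = x≢1
  zero-propagates (_◅_ {i} {k} e p) {x} x≢1 =
    subst (λ z → ¬ T (lookup z _)) (sym (iter-suc F (walkLength p) x))
      (zero-propagates p (λ Fxk → x≢1 (conj-true⇒ x k Fxk i e)))

  zero-recurs : ∀ {v} (c : Reach E v v) {x} →
    ¬ T (lookup x v) → ∀ m → ¬ T (lookup (iter F (m * walkLength c) x) v)
  zero-recurs c     x≢1 zero    = x≢1
  zero-recurs c {x} x≢1 (suc m) =
    subst (λ z → ¬ T (lookup z _)) (sym (iter-+ F (walkLength c) (m * walkLength c) x))
      (zero-propagates c (zero-recurs c x≢1 m))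

  -- A 0 at time ℓ = |c| recurs at time (k+1)·ℓ, a multiple of the period k+1.
  periodic-zero-on-cycle : ∀ {y} → Periodic F y → ∀ {v} (c : Reach E v v) →
    ¬ T (lookup (iter F (walkLength c) y) v) → ¬ T (lookup y v)
  periodic-zero-on-cycle {y} (k , p) c ℓ-zero =
    subst (λ z → ¬ T (lookup z _)) back (zero-recurs c ℓ-zero k)
    where
    ℓ = walkLength c
    open ≡-Reasoning
    back : iter F (k * ℓ) (iter F ℓ y) ≡ y
    back = begin
      iter F (k * ℓ) (iter F ℓ y) ≡⟨ iter-comm F (k * ℓ) ℓ y ⟩
      iter F ℓ (iter F (k * ℓ) y) ≡⟨ sym (iter-+ F ℓ (k * ℓ) y) ⟩
      iter F (suc k * ℓ) y        ≡⟨ cong (λ s → iter F s y) (*-comm (suc k) ℓ) ⟩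
      iter F (ℓ * suc k) y        ≡⟨ iter-*-fixed F (suc k) p ℓ ⟩
      y                           ∎

  periodic-one-along-cycle : ∀ {y} → Periodic F y → ∀ {w j} → Edge E w j → Reach E j w →
    T (lookup y w) → T (lookup (F y) j)
  periodic-one-along-cycle {y} per {w} {j} e q yw = decidable-stable (T? _) λ Fyj≢1 →
    periodic-zero-on-cycle per (e ◅ q)
      (subst (λ z → ¬ T (lookup z w)) (sym (iter-suc F (walkLength q) y)) (zero-propagates q Fyj≢1)) yw

splitLastEdge : ∀ {n} {E : Graph n} {a b c} →
  Edge E a b → Reach E b c → ∃ λ w → Reach E a w × Edge E w c
splitLastEdge {a = a} e ε = a , ε , e
splitLastEdge e (e' ◅ q) with splitLastEdge e' q
... | w , aw , wc = w , e ◅ aw , wc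

inEdgeWithinSCC : ∀ {n} (E : Graph n) → EverySCCHasEdge E → ∀ j → ∃ λ w → Edge E w j × Reach E j w
inEdgeWithinSCC E hasEdge j with hasEdge j
... | u , v , (ju , _) , (_ , vj) , uv with splitLastEdge uv vj
... | w , uw , wj = w , wj , (ju ◅◅ uw)

conj-agree-on-periodic : ∀ {n} (D D' : Graph n) →
  (∀ i j → Edge D' i j → Edge D i j) →
  (∀ i j → SameSCC D i j → Edge D i j → Edge D' i j) →
  EverySCCHasEdge D →
  ∀ y → Periodic (conj D) y → conj D y ≡ conj D' y
conj-agree-on-periodic D D' D'⊆D keepsSCC hasEdge y per = lookup-extensionality λ j →
  T-injective (fewer-inputs j) (inputs-within-SCC j)
  where
  fewer-inputs : ∀ j → T (lookup (conj D y) j) → T (lookup (conj D' y) j)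
  fewer-inputs j Fyj = conj-true⇐ D' y j λ i e' → conj-true⇒ D y j Fyj i (D'⊆D i j e')

  inputs-within-SCC : ∀ j → T (lookup (conj D' y) j) → T (lookup (conj D y) j)
  inputs-within-SCC j Gyj with inEdgeWithinSCC D hasEdge j
  ... | w , wj , jw = periodic-one-along-cycle D per wj jw
                        (conj-true⇒ D' y j Gyj w (keepsSCC w j (wj ◅ ε , jw) wj))

mainTheorem11 : ∀ (n : ℕ) (D D' : Graph n) →
    PositiveInDegree D → EverySCCHasEdge D → IsReduction D D' →
    (∀ (S : State n → Set) (t : ℕ) →
       IsLimitCycle (conj D) S t → IsLimitCycle (conj D') S t)
    × (∀ (k : ℕ) → cycleCount (conj D) k ≤ cycleCount (conj D') k)
mainTheorem11 n D D' _ hasEdge (D'⊆D , keepsSCC , _) =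
  (λ S t → limitCycle-transfer (conj D) (conj D') agree) ,
  (λ k → cycleCount-mono (conj D) (conj D') k λ u → minPeriod-transfer (conj D) (conj D') agree)
  where
  agree : ∀ y → Periodic (conj D) y → conj D y ≡ conj D' y
  agree = conj-agree-on-periodic D D' D'⊆D keepsSCC hasEdge
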